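{- Let $X$ be a simplicial complex on ground set $[n]$, and let $\Phi=\{\Phi_1,\dots,\Phi_k\}$ and $\Psi=\{\Psi_1,\dots,\Psi_\ell\}$ be set partitions of $[n]$ with $X_\Phi=X_\Psi$. Then $X_\Phi=X_\Psi=X_\Omega$, where $\Omega=\Phi\wedge\Psi$ is the common refinement, whose blocks are the nonempty sets $\Phi_i\cap\Psi_j$.
   Context: A simplicial complex on ground set $[n]$ is a family $X\subseteq 2^{[n]}$ with $\emptyset\in X$ that is closed under taking subsets (elements of $[n]$ that are not vertices are allowed). For $S\subseteq[n]$, $X|_S=\{\sigma\in X:\sigma\subseteq S\}$. For a set partition $\Phi=\{\Phi_1,\dots,\Phi_k\}$ of $[n]$, $X_\Phi=X|_{\Phi_1}*\cdots*X|_{\Phi_k}=\{\sigma_1\cup\cdots\cup\sigma_k:\sigma_i\in X,\ \sigma_i\subseteq\Phi_i\}$. -}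

module Defs where

open import Data.Nat using (ℕ)
open import Data.Fin using (Fin)
open import Data.Fin.Subset using (Subset; _∈_; _⊆_; ⊥; ⋃)
open import Data.List using (tabulate)
open import Data.Product using (Σ; ∃; _×_; _,_)
open import Relation.Binary.PropositionalEquality using (_≡_)
open import Function.Bundles using (_⇔_)

Family : ℕ → Set₁
Family n = Subset n → Set

record IsSimplicialComplex {n : ℕ} (X : Family n) : Set where
  field
    has-empty : X ⊥
    down-closed : ∀ {σ τ : Subset n} → τ ⊆ σ → X σ → X τ

-- A set partition of [n] into k blocks, given by its block-assignment map
-- φ : [n] → [k]; block i is Φ_i = {x | φ x ≡ i}. Blocks are nonempty,
-- i.e. φ is surjective.
record SetPartition (n : ℕ) : Set where
  field
    k : ℕ
    block : Fin n → Fin k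
    nonempty : ∀ (i : Fin k) → ∃ λ x → block x ≡ i
open SetPartition public

JoinBy : {n m : ℕ} → Family n → (Fin n → Fin m) → Family n
JoinBy {n} {m} X β σ =
  Σ (Fin m → Subset n) λ τ →
    (∀ i → X (τ i)) ×
    (∀ i x → x ∈ τ i → β x ≡ i) ×
    (σ ≡ ⋃ (tabulate τ))

Join : {n : ℕ} → Family n → SetPartition n → Family n
Join X Φ = JoinBy X (block Φ)

-- Join with respect to the common refinement Φ ∧ Ψ: the blocks are indexed by
-- pairs (i , j) with block Φ_i ∩ Ψ_j. Pairs with empty intersection contribute
-- only τ = ∅ (which lies in X), so this equals the join over the nonempty
-- blocks Φ_i ∩ Ψ_j, i.e. X_Ω.
JoinMeet : {n : ℕ} → Family n → SetPartition n → SetPartition n → Family n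
JoinMeet {n} X Φ Ψ σ =
  Σ (Fin (k Φ) → Fin (k Ψ) → Subset n) λ τ →
    (∀ i j → X (τ i j)) ×
    (∀ i j x → x ∈ τ i j → (block Φ x ≡ i) × (block Ψ x ≡ j)) ×
    (σ ≡ ⋃ (tabulate (λ i → ⋃ (tabulate (τ i)))))

_≐_ : {n : ℕ} → Family n → Family n → Set
X ≐ Y = ∀ σ → X σ ⇔ Y σ

{-# OPTIONS --safe #-}
-- For down-closed X, a face σ lies in the join X_β exactly when each restriction
-- σ ∩ β⁻¹(i) lies in X.  Hence joining twice along the same partition changes nothing,
-- and since X_Φ∧Ψ is X_Ψ joined along Φ, the hypothesis gives
-- X_Φ∧Ψ = (X_Ψ)_Φ = (X_Φ)_Φ = X_Φ.
module Submission where

open import Defs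
open import Data.Nat using (ℕ)
open import Data.Bool.Properties using (T-≡)
open import Data.Product using (_×_; _,_; ∃; proj₁; proj₂)
open import Data.Sum using (inj₁; inj₂; [_,_]′)
open import Data.Fin using (Fin; _≟_)
open import Data.Fin.Subset using (Subset; _∈_; _⊆_; _∩_; ⋃)
open import Data.Fin.Subset.Properties
  using (⊆-antisym; p∩q⊆p; x∈p∩q⁺; x∈p∩q⁻; x∈p∪q⁺; x∈p∪q⁻; ∉⊥; ∩-assoc; ∩-idem)
open import Data.List using (List; []; _∷_; tabulate)
open import Data.List.Properties using (tabulate-cong)
open import Data.List.Relation.Unary.Any using (Any; here; there)
import Data.List.Relation.Unary.Any.Properties as Any
import Data.Vec as Vec
open import Data.Vec.Properties using (lookup∘tabulate; lookup⇒[]=; []=⇒lookup)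
open import Function using (_∘_)
open import Function.Bundles using (_⇔_; mk⇔; Equivalence)
import Function.Properties.Equivalence as ⇔
open import Level using (0ℓ) renaming (suc to lsuc)
open import Relation.Binary.Bundles using (Setoid)
import Relation.Binary.Reasoning.Setoid as SetoidReasoning
open import Relation.Binary.PropositionalEquality using (_≡_; refl; sym; trans; subst; cong)
open import Relation.Nullary using (contradiction)
open import Relation.Nullary.Decidable using (⌊_⌋; toWitness; fromWitness)

open Equivalence using (to; from)

private variable
  n m : ℕ
  x : Fin n

x∈⋃⁺ : {ps : List (Subset n)} → Any (x ∈_) ps → x ∈ ⋃ ps
x∈⋃⁺ (here x∈p)    = x∈p∪q⁺ (inj₁ x∈p)
x∈⋃⁺ (there x∈ps) = x∈p∪q⁺ (inj₂ (x∈⋃⁺ x∈ps))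

x∈⋃⁻ : (ps : List (Subset n)) → x ∈ ⋃ ps → Any (x ∈_) ps
x∈⋃⁻ []       x∈⊥   = contradiction x∈⊥ ∉⊥
x∈⋃⁻ (p ∷ ps) x∈p∪ = [ here , there ∘ x∈⋃⁻ ps ]′ (x∈p∪q⁻ p (⋃ ps) x∈p∪)

x∈⋃-tabulate⁺ : (τ : Fin m → Subset n) (i : Fin m) → x ∈ τ i → x ∈ ⋃ (tabulate τ)
x∈⋃-tabulate⁺ τ i = x∈⋃⁺ ∘ Any.tabulate⁺ i

x∈⋃-tabulate⁻ : (τ : Fin m → Subset n) → x ∈ ⋃ (tabulate τ) → ∃ λ i → x ∈ τ i
x∈⋃-tabulate⁻ τ = Any.tabulate⁻ ∘ x∈⋃⁻ (tabulate τ)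

fiber : (Fin n → Fin m) → Fin m → Subset n
fiber β i = Vec.tabulate (λ x → ⌊ β x ≟ i ⌋)

x∈fiber⁺ : (β : Fin n → Fin m) {i : Fin m} {x : Fin n} → β x ≡ i → x ∈ fiber β i
x∈fiber⁺ β {i} {x} βx≡i =
  lookup⇒[]= x (fiber β i) (trans (lookup∘tabulate _ x) (to T-≡ (fromWitness βx≡i)))

x∈fiber⁻ : (β : Fin n → Fin m) {i : Fin m} {x : Fin n} → x ∈ fiber β i → β x ≡ i
x∈fiber⁻ β {i} {x} x∈fiber =
  toWitness (from T-≡ (trans (sym (lookup∘tabulate _ x)) ([]=⇒lookup x∈fiber)))

∩-monoˡ-⊆ : {p q r : Subset n} → p ⊆ q → p ∩ r ⊆ q ∩ r
∩-monoˡ-⊆ {p = p} {r = r} p⊆q x∈p∩r =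
  let x∈p , x∈r = x∈p∩q⁻ p r x∈p∩r in x∈p∩q⁺ (p⊆q x∈p , x∈r)

∩-absorbʳ : (p q : Subset n) → (p ∩ q) ∩ q ≡ p ∩ q
∩-absorbʳ p q = trans (∩-assoc p q q) (cong (p ∩_) (∩-idem q))

restrict-⊆-piece : {σ : Subset n} (β : Fin n → Fin m) (τ : Fin m → Subset n) →
  (∀ i x → x ∈ τ i → β x ≡ i) → σ ≡ ⋃ (tabulate τ) → ∀ i → σ ∩ fiber β i ⊆ τ i
restrict-⊆-piece {σ = σ} β τ τ⊆fiber refl i {x} x∈σ∩fiber =
  let x∈σ , x∈fiber = x∈p∩q⁻ σ (fiber β i) x∈σ∩fiber
      j , x∈τj      = x∈⋃-tabulate⁻ τ x∈σ
      j≡i           = trans (sym (τ⊆fiber j x x∈τj)) (x∈fiber⁻ β x∈fiber)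
  in subst (λ j → x ∈ τ j) j≡i x∈τj

⋃-restrict-fibers : (β : Fin n → Fin m) (σ : Subset n) →
  σ ≡ ⋃ (tabulate (λ i → σ ∩ fiber β i))
⋃-restrict-fibers β σ = ⊆-antisym
  (λ {x} x∈σ → x∈⋃-tabulate⁺ _ (β x) (x∈p∩q⁺ (x∈σ , x∈fiber⁺ β refl)))
  (λ x∈⋃ → let i , x∈σ∩fiber = x∈⋃-tabulate⁻ _ x∈⋃ in p∩q⊆p σ (fiber β i) x∈σ∩fiber)

DownClosed : Family n → Set
DownClosed {n} X = ∀ {σ τ : Subset n} → τ ⊆ σ → X σ → X τ

joinBy-mono : {X Y : Family n} (β : Fin n → Fin m) →
  (∀ σ → X σ → Y σ) → ∀ σ → JoinBy X β σ → JoinBy Y β σ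
joinBy-mono β X⊆Y σ (τ , Xτ , τ⊆fiber , σ≡⋃τ) = τ , (λ i → X⊆Y (τ i) (Xτ i)) , τ⊆fiber , σ≡⋃τ

joinBy-cong : {X Y : Family n} (β : Fin n → Fin m) → X ≐ Y → JoinBy X β ≐ JoinBy Y β
joinBy-cong β X≐Y σ =
  mk⇔ (joinBy-mono β (λ τ → to (X≐Y τ)) σ) (joinBy-mono β (λ τ → from (X≐Y τ)) σ)

module _ {X : Family n} (β : Fin n → Fin m) where

  restrictions⇒joinBy : {σ : Subset n} → (∀ i → X (σ ∩ fiber β i)) → JoinBy X β σ
  restrictions⇒joinBy {σ} Xσ∩fiber =
    (λ i → σ ∩ fiber β i) ,
    Xσ∩fiber ,
    (λ i x x∈σ∩fiber → x∈fiber⁻ β (proj₂ (x∈p∩q⁻ σ (fiber β i) x∈σ∩fiber))) ,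
    ⋃-restrict-fibers β σ

  module _ (down-closed : DownClosed X) where

    joinBy⇒restrictions : {σ : Subset n} → JoinBy X β σ → ∀ i → X (σ ∩ fiber β i)
    joinBy⇒restrictions (τ , Xτ , τ⊆fiber , σ≡⋃τ) i =
      down-closed (restrict-⊆-piece β τ τ⊆fiber σ≡⋃τ i) (Xτ i)

    ⊆-joinBy : {σ : Subset n} → X σ → JoinBy X β σ
    ⊆-joinBy {σ} Xσ = restrictions⇒joinBy (λ i → down-closed (p∩q⊆p σ (fiber β i)) Xσ)

    joinBy-downClosed : DownClosed (JoinBy X β)
    joinBy-downClosed τ⊆σ Jσ = restrictions⇒joinBy λ i →
      down-closed (∩-monoˡ-⊆ τ⊆σ) (joinBy⇒restrictions Jσ i)

joinBy-idem : {X : Family n} → DownClosed X → (β : Fin n → Fin m) →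
  JoinBy (JoinBy X β) β ≐ JoinBy X β
joinBy-idem {X = X} down-closed β σ =
  mk⇔ joinBy²⇒joinBy (⊆-joinBy {X = JoinBy X β} β (joinBy-downClosed β down-closed))
  where
  joinBy²⇒joinBy : JoinBy (JoinBy X β) β σ → JoinBy X β σ
  joinBy²⇒joinBy JJσ = restrictions⇒joinBy {X = X} β λ i →
    subst X (∩-absorbʳ σ (fiber β i))
      (joinBy⇒restrictions β down-closed
        (joinBy⇒restrictions {X = JoinBy X β} β (joinBy-downClosed β down-closed) JJσ i) i)

joinMeet≐joinBy-join : (X : Family n) (Φ Ψ : SetPartition n) →
  JoinMeet X Φ Ψ ≐ JoinBy (Join X Ψ) (block Φ)
joinMeet≐joinBy-join {n} X Φ Ψ σ = mk⇔ joinMeet⇒joinBy joinBy⇒joinMeet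
  where
  joinMeet⇒joinBy : JoinMeet X Φ Ψ σ → JoinBy (Join X Ψ) (block Φ) σ
  joinMeet⇒joinBy (τ , Xτ , τ⊆Φ∩Ψ , σ≡⋃τ) =
    (λ i → ⋃ (tabulate (τ i))) ,
    (λ i → τ i , Xτ i , (λ j x → proj₂ ∘ τ⊆Φ∩Ψ i j x) , refl) ,
    ⋃τ⊆Φ ,
    σ≡⋃τ
    where
    ⋃τ⊆Φ : ∀ i x → x ∈ ⋃ (tabulate (τ i)) → block Φ x ≡ i
    ⋃τ⊆Φ i x x∈⋃τi = let j , x∈τij = x∈⋃-tabulate⁻ (τ i) x∈⋃τi in proj₁ (τ⊆Φ∩Ψ i j x x∈τij)

  joinBy⇒joinMeet : JoinBy (Join X Ψ) (block Φ) σ → JoinMeet X Φ Ψ σ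
  joinBy⇒joinMeet (ρ , Jρ , ρ⊆Φ , σ≡⋃ρ) =
    τ , Xτ , τ⊆Φ∩Ψ , trans σ≡⋃ρ (cong ⋃ (tabulate-cong ρ≡⋃τ))
    where
    τ : Fin (k Φ) → Fin (k Ψ) → Subset n
    τ i = proj₁ (Jρ i)
    Xτ : ∀ i j → X (τ i j)
    Xτ i = proj₁ (proj₂ (Jρ i))
    τ⊆Ψ : ∀ i j x → x ∈ τ i j → block Ψ x ≡ j
    τ⊆Ψ i = proj₁ (proj₂ (proj₂ (Jρ i)))
    ρ≡⋃τ : ∀ i → ρ i ≡ ⋃ (tabulate (τ i))
    ρ≡⋃τ i = proj₂ (proj₂ (proj₂ (Jρ i)))
    τ⊆Φ∩Ψ : ∀ i j x → x ∈ τ i j → (block Φ x ≡ i) × (block Ψ x ≡ j)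
    τ⊆Φ∩Ψ i j x x∈τij =
      ρ⊆Φ i x (subst (x ∈_) (sym (ρ≡⋃τ i)) (x∈⋃-tabulate⁺ (τ i) j x∈τij)) , τ⊆Ψ i j x x∈τij

≐-setoid : ℕ → Setoid (lsuc 0ℓ) 0ℓ
≐-setoid n = record
  { Carrier       = Family n
  ; _≈_           = _≐_
  ; isEquivalence = record
    { refl  = λ σ → ⇔.refl
    ; sym   = λ X≐Y σ → ⇔.sym (X≐Y σ)
    ; trans = λ X≐Y Y≐Z σ → ⇔.trans (X≐Y σ) (Y≐Z σ)
    }
  }

proposition5p1 : (n : ℕ) (X : Family n) → IsSimplicialComplex X →
    (Φ Ψ : SetPartition n) → Join X Φ ≐ Join X Ψ →
    (Join X Φ ≐ JoinMeet X Φ Ψ) × (Join X Ψ ≐ JoinMeet X Φ Ψ)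
proposition5p1 n X SC Φ Ψ Φ≐Ψ = Φ≐Ω , Ψ≐Ω
  where
  open IsSimplicialComplex SC using (down-closed)
  open SetoidReasoning (≐-setoid n)

  Φ≐Ω : Join X Φ ≐ JoinMeet X Φ Ψ
  Φ≐Ω = begin
    Join X Φ                    ≈⟨ joinBy-idem down-closed (block Φ) ⟨
    JoinBy (Join X Φ) (block Φ) ≈⟨ joinBy-cong (block Φ) Φ≐Ψ ⟩
    JoinBy (Join X Ψ) (block Φ) ≈⟨ joinMeet≐joinBy-join X Φ Ψ ⟨
    JoinMeet X Φ Ψ              ∎

  Ψ≐Ω : Join X Ψ ≐ JoinMeet X Φ Ψ
  Ψ≐Ω = begin
    Join X Ψ       ≈⟨ Φ≐Ψ ⟨
    Join X Φ       ≈⟨ Φ≐Ω ⟩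
    JoinMeet X Φ Ψ ∎
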